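{- Let $M\in\mathbb{Z}^{m\times m}$ with $\det M=\Delta\neq0$ and let $\mathcal{D}\subset\mathbb{Z}^m$ be finite. Then: (1) $M^k\bigl(\mathrm{Fin}_{\mathcal{D}}(M)\bigr)=\mathrm{Fin}_{\mathcal{D}}(M)$ for each $k\in\mathbb{Z}$; (2) $\mathrm{Fin}_{\mathcal{D}}(M)\subseteq\bigcup_{k\in\mathbb{N}}\frac{1}{\Delta^k}\mathbb{Z}^m$; (3) if $\mathbb{Z}^m\subset\mathrm{Fin}_{\mathcal{D}}(M)$, then $\mathrm{Fin}_{\mathcal{D}}(M)$ is closed under addition and subtraction.
   Context: $\mathrm{Fin}_{\mathcal{D}}(M)=\bigl\{\sum_{k\in I}M^kd_k : I \text{ a finite non-empty subset of } \mathbb{Z},\ d_k\in\mathcal{D}\text{ for each } k\in I\bigr\}$, where $M^k$ for $k<0$ is a power of $M^{ -1}$. Digit sets are assumed to contain the zero vector. $\frac{1}{\Delta^k}\mathbb{Z}^m=\{\Delta^{ -k}z : z\in\mathbb{Z}^m\}$. -}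

module Defs where

open import Data.Nat as ℕ using (ℕ; zero; suc)
open import Data.Integer as ℤ using (ℤ; +_; -[1+_])
open import Data.Rational as ℚ using (ℚ; 0ℚ; 1ℚ)
open import Data.Rational.Properties using () renaming (_≟_ to _≟ℚ_)
open import Data.Fin using (Fin; zero; suc; toℕ; punchIn)
open import Data.List using (List; []; _∷_; map; length)
open import Data.List.Relation.Unary.Unique.Propositional using (Unique)
open import Data.Product using (Σ; ∃; _×_; _,_; proj₁; proj₂)
open import Relation.Nullary using (yes; no; ¬_)
open import Relation.Binary.PropositionalEquality using (_≡_; _≢_)

ZVec : ℕ → Set
ZVec m = Fin m → ℤ

ZMat : ℕ → Set
ZMat m = Fin m → Fin m → ℤ

QVec : ℕ → Set
QVec m = Fin m → ℚ

QMat : ℕ → Set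
QMat m = Fin m → Fin m → ℚ

ι : ℤ → ℚ
ι z = z ℚ./ 1

ιv : ∀ {m} → ZVec m → QVec m
ιv z i = ι (z i)

ιM : ∀ {m} → ZMat m → QMat m
ιM M i j = ι (M i j)

sumℤ : ∀ {n} → (Fin n → ℤ) → ℤ
sumℤ {zero} f = + 0
sumℤ {suc n} f = f zero ℤ.+ sumℤ (λ i → f (suc i))

sumℚ : ∀ {n} → (Fin n → ℚ) → ℚ
sumℚ {zero} f = 0ℚ
sumℚ {suc n} f = f zero ℚ.+ sumℚ (λ i → f (suc i))

sign : ℕ → ℤ
sign zero = + 1
sign (suc n) = ℤ.- sign n

minor : ∀ {n} → Fin (suc n) → Fin (suc n) → ZMat (suc n) → ZMat n
minor i j M a b = M (punchIn i a) (punchIn j b)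

det : ∀ {n} → ZMat n → ℤ
det {zero} M = + 1
det {suc n} M = sumℤ (λ j → sign (toℕ j) ℤ.* (M zero j ℤ.* det (minor zero j M)))

adj : ∀ {n} → ZMat n → ZMat n
adj {zero} M ()
adj {suc n} M i j = sign (toℕ i ℕ.+ toℕ j) ℤ.* det (minor j i M)

-- total reciprocal (0 ↦ 0); only used when the argument is nonzero
recip : ℚ → ℚ
recip p with p ≟ℚ 0ℚ
... | yes _ = 0ℚ
... | no p≢0 = ℚ.1/_ p {{ℚ.≢-nonZero p≢0}}

-- M⁻¹ = (1/det M) adj M  (the genuine inverse when det M ≠ 0)
inv : ∀ {m} → ZMat m → QMat m
inv M i j = recip (ι (det M)) ℚ.* ι (adj M i j)

idQ : ∀ {m} → QMat m
idQ i j with i Data.Fin.≟ j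
... | yes _ = 1ℚ
... | no _ = 0ℚ

_⊗_ : ∀ {m} → QMat m → QMat m → QMat m
(A ⊗ B) i j = sumℚ (λ l → A i l ℚ.* B l j)

_·_ : ∀ {m} → QMat m → QVec m → QVec m
(A · x) i = sumℚ (λ l → A i l ℚ.* x l)

powN : ∀ {m} → QMat m → ℕ → QMat m
powN A zero = idQ
powN A (suc n) = A ⊗ powN A n

_^ᶻ_ : ∀ {m} → ZMat m → ℤ → QMat m
M ^ᶻ (+ n) = powN (ιM M) n
M ^ᶻ -[1+ n ] = powN (inv M) (suc n)

_+ᵥ_ : ∀ {m} → QVec m → QVec m → QVec m
(x +ᵥ y) i = x i ℚ.+ y i

_-ᵥ_ : ∀ {m} → QVec m → QVec m → QVec m
(x -ᵥ y) i = x i ℚ.- y i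

0ᵥ : ∀ {m} → QVec m
0ᵥ i = 0ℚ

_≋_ : ∀ {m} → QVec m → QVec m → Set
x ≋ y = ∀ i → x i ≡ y i

-- A finite digit set 𝒟 ⊂ ℤ^m is given as a list; a digit is chosen by its index.
Digits : ℕ → Set
Digits m = List (ZVec m)

digit : ∀ {m} (D : Digits m) → Fin (length D) → ZVec m
digit (d ∷ D) zero = d
digit (d ∷ D) (suc j) = digit D j

HasZero : ∀ {m} → Digits m → Set
HasZero D = Σ (Fin (length D)) λ j → ∀ i → digit D j i ≡ + 0

-- A representation: a finite list of (k , d_k) with pairwise distinct exponents k
-- (so the exponents form a finite set I), and I non-empty.
Rep : ∀ {m} → Digits m → Set
Rep D = Σ (List (ℤ × Fin (length D))) λ ks → Unique (map proj₁ ks) × ks ≢ []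

evalList : ∀ {m} (M : ZMat m) (D : Digits m) → List (ℤ × Fin (length D)) → QVec m
evalList M D [] = 0ᵥ
evalList M D ((k , j) ∷ ks) = ((M ^ᶻ k) · ιv (digit D j)) +ᵥ evalList M D ks

FinD : ∀ {m} → ZMat m → Digits m → QVec m → Set
FinD M D x = Σ (Rep D) λ r → x ≋ evalList M D (proj₁ r)

InScaledLattice : ∀ {m} → ℤ → ℕ → QVec m → Set
InScaledLattice {m} Δ k x = Σ (ZVec m) λ z → ∀ i → x i ≡ recip (ι (Δ ℤ.^ k)) ℚ.* ι (z i)

module Submission where

-- Shifting every exponent of a digit expansion by k multiplies it by M^k, so
-- Fin_𝒟(M) is invariant under all integer powers of M, whose negative powers
-- are powers of Δ⁻¹ adj M (Laplace expansion and alien cofactors).  Every x in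
-- Fin_𝒟(M) is eventually integral: M^N x ∈ ℤ^m once N exceeds the most negative
-- exponent.  Then x = (Δ⁻¹ adj M)^N (M^N x) has denominator Δ^N; and if
-- ℤ^m ⊆ Fin_𝒟(M), then for x, y ∈ Fin_𝒟(M) and a common such N the integer
-- vector M^N (x ± y) lies in Fin_𝒟(M), hence so does x ± y by invariance.

open import Defs

open import Level using (Level)
open import Data.Nat as ℕ using (ℕ; zero; suc)
import Data.Nat.Properties as ℕP
open import Data.Integer using (ℤ; +_; -[1+_])
import Data.Integer as ℤ
import Data.Integer.Properties as ℤP
open import Data.Integer.Tactic.RingSolver using (solve-∀)
open import Data.Fin as Fin using (Fin; zero; suc; toℕ; punchIn)
import Data.Fin.Properties as FinP
open import Data.Empty using (⊥-elim)
open import Function using (_∘_)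
open import Algebra.Bundles using (CommutativeRing; CommutativeMonoid; AbelianGroup)
import Algebra.Properties.Group
import Relation.Binary.Reasoning.Setoid
open import Data.Product using (Σ; Σ-syntax; _×_; _,_; proj₁; proj₂; map₁)
open import Data.Sum using (inj₁; inj₂)
open import Data.List using (List; []; _∷_; map; length)
import Data.List.Properties as ListP
open import Data.List.Relation.Unary.Unique.Propositional using (Unique)
import Data.List.Relation.Unary.Unique.Propositional.Properties as UniqueP
open import Relation.Binary.PropositionalEquality using (_≢_)

module FiniteSum {c ℓ : Level} (R : CommutativeRing c ℓ) where

  open CommutativeRing R hiding (zero)
  open import Algebra.Properties.Ring ring using (-‿+-comm; -0#≈0#)
  open import Algebra.Properties.CommutativeSemigroup +-commutativeSemigroup
    using (interchange)
  open import Relation.Binary.Reasoning.Setoid setoid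

  -- ∑ is a parameter, so that the laws apply directly to sumℤ and sumℚ,
  -- whose defining equations hold by refl.
  module Laws (∑ : ∀ {n} → (Fin n → Carrier) → Carrier)
              (∑-empty : (f : Fin 0 → Carrier) → ∑ f ≈ 0#)
              (∑-suc : ∀ {n} (f : Fin (suc n) → Carrier) → ∑ f ≈ f zero + ∑ (f ∘ suc))
              where

    ∑-cong : ∀ {n} {f g : Fin n → Carrier} → (∀ i → f i ≈ g i) → ∑ f ≈ ∑ g
    ∑-cong {zero}  {f} {g} _   = trans (∑-empty f) (sym (∑-empty g))
    ∑-cong {suc n} {f} {g} f≈g = begin
      ∑ f                   ≈⟨ ∑-suc f ⟩
      f zero + ∑ (f ∘ suc)  ≈⟨ +-cong (f≈g zero) (∑-cong (f≈g ∘ suc)) ⟩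
      g zero + ∑ (g ∘ suc)  ≈⟨ ∑-suc g ⟨
      ∑ g                   ∎

    ∑-zero : ∀ n → ∑ {n} (λ _ → 0#) ≈ 0#
    ∑-zero zero    = ∑-empty _
    ∑-zero (suc n) = trans (∑-suc _) (trans (+-congˡ (∑-zero n)) (+-identityˡ 0#))

    ∑-distrib-+ : ∀ {n} (f g : Fin n → Carrier) → ∑ (λ i → f i + g i) ≈ ∑ f + ∑ g
    ∑-distrib-+ {zero} f g = begin
      ∑ (λ i → f i + g i)  ≈⟨ ∑-empty _ ⟩
      0#                   ≈⟨ +-identityˡ 0# ⟨
      0# + 0#              ≈⟨ +-cong (∑-empty f) (∑-empty g) ⟨
      ∑ f + ∑ g            ∎
    ∑-distrib-+ {suc n} f g = begin
      ∑ (λ i → f i + g i)                          ≈⟨ ∑-suc _ ⟩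
      (f zero + g zero) + ∑ (λ i → f (suc i) + g (suc i))
                                                   ≈⟨ +-congˡ (∑-distrib-+ (f ∘ suc) (g ∘ suc)) ⟩
      (f zero + g zero) + (∑ (f ∘ suc) + ∑ (g ∘ suc)) ≈⟨ interchange _ _ _ _ ⟩
      (f zero + ∑ (f ∘ suc)) + (g zero + ∑ (g ∘ suc)) ≈⟨ +-cong (∑-suc f) (∑-suc g) ⟨
      ∑ f + ∑ g                                    ∎

    *-distribˡ-∑ : ∀ {n} x (f : Fin n → Carrier) → x * ∑ f ≈ ∑ (λ i → x * f i)
    *-distribˡ-∑ {zero} x f = begin
      x * ∑ f  ≈⟨ *-congˡ (∑-empty f) ⟩
      x * 0#   ≈⟨ zeroʳ x ⟩
      0#       ≈⟨ ∑-empty _ ⟨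
      ∑ (λ i → x * f i) ∎
    *-distribˡ-∑ {suc n} x f = begin
      x * ∑ f                                ≈⟨ *-congˡ (∑-suc f) ⟩
      x * (f zero + ∑ (f ∘ suc))             ≈⟨ distribˡ x _ _ ⟩
      x * f zero + x * ∑ (f ∘ suc)           ≈⟨ +-congˡ (*-distribˡ-∑ x (f ∘ suc)) ⟩
      x * f zero + ∑ (λ i → x * f (suc i))   ≈⟨ ∑-suc _ ⟨
      ∑ (λ i → x * f i)                      ∎

    *-distribʳ-∑ : ∀ {n} x (f : Fin n → Carrier) → ∑ f * x ≈ ∑ (λ i → f i * x)
    *-distribʳ-∑ x f =
      trans (*-comm _ x) (trans (*-distribˡ-∑ x f) (∑-cong (λ i → *-comm x (f i))))

    ∑-neg : ∀ {n} (f : Fin n → Carrier) → ∑ (λ i → - f i) ≈ - ∑ f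
    ∑-neg {zero} f = trans (∑-empty _) (trans (sym -0#≈0#) (-‿cong (sym (∑-empty f))))
    ∑-neg {suc n} f = begin
      ∑ (λ i → - f i)               ≈⟨ ∑-suc _ ⟩
      - f zero + ∑ (λ i → - f (suc i)) ≈⟨ +-congˡ (∑-neg (f ∘ suc)) ⟩
      - f zero + - ∑ (f ∘ suc)      ≈⟨ -‿+-comm (f zero) _ ⟩
      - (f zero + ∑ (f ∘ suc))      ≈⟨ -‿cong (∑-suc f) ⟨
      - ∑ f                         ∎

    ∑-comm : ∀ {n k} (f : Fin n → Fin k → Carrier) →
             ∑ (λ i → ∑ (λ j → f i j)) ≈ ∑ (λ j → ∑ (λ i → f i j))
    ∑-comm {zero} {k} f = begin
      ∑ (λ i → ∑ (f i))                 ≈⟨ ∑-empty _ ⟩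
      0#                                ≈⟨ ∑-zero k ⟨
      ∑ {k} (λ _ → 0#)                  ≈⟨ ∑-cong (λ j → ∑-empty _) ⟨
      ∑ (λ j → ∑ (λ i → f i j))         ∎
    ∑-comm {suc n} f = begin
      ∑ (λ i → ∑ (f i))                             ≈⟨ ∑-suc _ ⟩
      ∑ (f zero) + ∑ (λ i → ∑ (f (suc i)))          ≈⟨ +-congˡ (∑-comm (f ∘ suc)) ⟩
      ∑ (f zero) + ∑ (λ j → ∑ (λ i → f (suc i) j))  ≈⟨ ∑-distrib-+ _ _ ⟨
      ∑ (λ j → f zero j + ∑ (λ i → f (suc i) j))    ≈⟨ ∑-cong (λ j → ∑-suc _) ⟨
      ∑ (λ j → ∑ (λ i → f i j))                     ∎

    ∑-single : ∀ {n} (i : Fin n) (f : Fin n → Carrier) →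
               (∀ l → l ≢ i → f l ≈ 0#) → ∑ f ≈ f i
    ∑-single {suc n} zero f vanish = begin
      ∑ f                   ≈⟨ ∑-suc f ⟩
      f zero + ∑ (f ∘ suc)  ≈⟨ +-congˡ (trans (∑-cong (λ l → vanish (suc l) λ ())) (∑-zero n)) ⟩
      f zero + 0#           ≈⟨ +-identityʳ _ ⟩
      f zero                ∎
    ∑-single {suc n} (suc i) f vanish = begin
      ∑ f                   ≈⟨ ∑-suc f ⟩
      f zero + ∑ (f ∘ suc)  ≈⟨ +-cong (vanish zero λ ())
                                      (∑-single i (f ∘ suc) λ l l≢i → vanish (suc l) (l≢i ∘ FinP.suc-injective)) ⟩
      0# + f (suc i)        ≈⟨ +-identityˡ _ ⟩
      f (suc i)             ∎

open import Relation.Binary.PropositionalEquality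
open import Relation.Nullary using (yes; no)

module ℤ∑ = FiniteSum.Laws ℤP.+-*-commutativeRing sumℤ (λ _ → refl) (λ _ → refl)

module Determinant where

  open ℤ∑
  open import Data.Integer using (_+_; _*_; -_)
  open ≡-Reasoning

  det-cong : ∀ {n} {A B : ZMat n} → (∀ i j → A i j ≡ B i j) → det A ≡ det B
  det-cong {zero}  _   = refl
  det-cong {suc n} A≡B = ∑-cong λ j →
    cong₂ (λ a d → sign (toℕ j) * (a * d)) (A≡B zero j) (det-cong λ a b → A≡B (suc a) (punchIn j b))

  transpose : ∀ {n} → ZMat n → ZMat n
  transpose M i j = M j i

  sign-+ : ∀ a b → sign (a ℕ.+ b) ≡ sign a * sign b
  sign-+ zero    b = sym (ℤP.*-identityˡ (sign b))
  sign-+ (suc a) b = trans (cong -_ (sign-+ a b)) (ℤP.neg-distribˡ-* (sign a) (sign b))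

  sign-involutive : ∀ k → sign k * sign k ≡ + 1
  sign-involutive zero    = refl
  sign-involutive (suc k) = trans (neg*neg (sign k)) (sign-involutive k)
    where
    neg*neg : ∀ s → - s * - s ≡ s * s
    neg*neg = solve-∀

  sign*x≡0⇒x≡0 : ∀ k x → sign k * x ≡ + 0 → x ≡ + 0
  sign*x≡0⇒x≡0 k x e = begin
    x                      ≡⟨ ℤP.*-identityˡ x ⟨
    + 1 * x                ≡⟨ cong (_* x) (sign-involutive k) ⟨
    (sign k * sign k) * x  ≡⟨ ℤP.*-assoc (sign k) (sign k) x ⟩
    sign k * (sign k * x)  ≡⟨ cong (sign k *_) e ⟩
    sign k * + 0           ≡⟨ ℤP.*-zeroʳ (sign k) ⟩
    + 0                    ∎

  x≡-x⇒x≡0 : ∀ x → x ≡ - x → x ≡ + 0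
  x≡-x⇒x≡0 (+ zero) _ = refl
  x≡-x⇒x≡0 (+ suc n) ()
  x≡-x⇒x≡0 -[1+ n ]  ()

  det-firstColumn : ∀ n (N : ZMat (suc n)) →
    det N ≡ sumℤ (λ i → sign (toℕ i) * (N i zero * det (minor i zero N)))
  det-firstColumn zero    N = refl
  det-firstColumn (suc n) N = cong (_+_ (sign 0 * (N zero zero * det (minor zero zero N)))) (begin
      sumℤ (λ b → - sign (toℕ b) * (N zero (suc b) * det (minor zero (suc b) N)))
        ≡⟨ ∑-cong (λ b → cong (λ t → - sign (toℕ b) * (N zero (suc b) * t)) (det-firstColumn n (minor zero (suc b) N))) ⟩
      sumℤ (λ b → - sign (toℕ b) * (N zero (suc b) * sumℤ (λ i → sign (toℕ i) * (N (suc i) zero * D b i))))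
        ≡⟨ ∑-cong (λ b → pull (- sign (toℕ b)) (N zero (suc b)) (λ i → sign (toℕ i) * (N (suc i) zero * D b i))) ⟩
      sumℤ (λ b → sumℤ (λ i → - sign (toℕ b) * (N zero (suc b) * (sign (toℕ i) * (N (suc i) zero * D b i)))))
        ≡⟨ ∑-cong (λ b → ∑-cong (λ i → exchange (sign (toℕ b)) (N zero (suc b)) (sign (toℕ i)) (N (suc i) zero) (D b i))) ⟩
      sumℤ (λ b → sumℤ (λ i → - sign (toℕ i) * (N (suc i) zero * (sign (toℕ b) * (N zero (suc b) * D b i)))))
        ≡⟨ ∑-comm (λ b i → - sign (toℕ i) * (N (suc i) zero * (sign (toℕ b) * (N zero (suc b) * D b i)))) ⟩
      sumℤ (λ i → sumℤ (λ b → - sign (toℕ i) * (N (suc i) zero * (sign (toℕ b) * (N zero (suc b) * D b i)))))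
        ≡⟨ ∑-cong (λ i → pull (- sign (toℕ i)) (N (suc i) zero) (λ b → sign (toℕ b) * (N zero (suc b) * D b i))) ⟨
      sumℤ (λ i → - sign (toℕ i) * (N (suc i) zero * det (minor (suc i) zero N))) ∎)
    where
    -- Expanding the first-row minors along their first column, both sides become the
    -- double sum over D b i, the minor of N without rows 0, i+1 and columns 0, b+1.
    D : Fin (suc n) → Fin (suc n) → ℤ
    D b i = det (λ x y → N (suc (punchIn i x)) (suc (punchIn b y)))
    pull : ∀ {k} a b (f : Fin k → ℤ) → a * (b * sumℤ f) ≡ sumℤ (λ i → a * (b * f i))
    pull a b f = trans (cong (a *_) (*-distribˡ-∑ b f)) (*-distribˡ-∑ a (λ i → b * f i))
    exchange : ∀ s a t c d → - s * (a * (t * (c * d))) ≡ - t * (c * (s * (a * d)))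
    exchange = solve-∀

  det-transpose : ∀ n (N : ZMat n) → det (transpose N) ≡ det N
  det-transpose zero    N = refl
  det-transpose (suc n) N = trans
    (∑-cong λ j → cong (λ t → sign (toℕ j) * (N j zero * t)) (det-transpose n (minor j zero N)))
    (sym (det-firstColumn n N))

  swapRow₀₁ : ∀ {n} {A : Set} → (Fin (suc (suc n)) → A) → Fin (suc (suc n)) → A
  swapRow₀₁ N zero          = N (suc zero)
  swapRow₀₁ N (suc zero)    = N zero
  swapRow₀₁ N (suc (suc i)) = N (suc (suc i))

  det-swapRow₀₁ : ∀ n (N : ZMat (suc (suc n))) → det (swapRow₀₁ N) ≡ - det N
  det-swapRow₀₁ n N = begin
    det (swapRow₀₁ N)
      ≡⟨ det-firstColumn (suc n) (swapRow₀₁ N) ⟩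
    + 1 * (N (suc zero) zero * det (minor zero zero (swapRow₀₁ N)))
      + (- + 1 * (N zero zero * det (minor (suc zero) zero (swapRow₀₁ N))) + lowerTerms (swapRow₀₁ N))
      ≡⟨ cong₂ (λ u v → + 1 * (N (suc zero) zero * u) + (- + 1 * (N zero zero * v) + lowerTerms (swapRow₀₁ N)))
               (det-cong minor₀) (det-cong minor₁) ⟩
    + 1 * (N (suc zero) zero * B) + (- + 1 * (N zero zero * A) + lowerTerms (swapRow₀₁ N))
      ≡⟨ cong (λ t → + 1 * (N (suc zero) zero * B) + (- + 1 * (N zero zero * A) + t)) (lowerTerms-swap n N) ⟩
    + 1 * (N (suc zero) zero * B) + (- + 1 * (N zero zero * A) + - lowerTerms N)
      ≡⟨ rearrange (+ 1) (N (suc zero) zero) B (N zero zero) A (lowerTerms N) ⟩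
    - (+ 1 * (N zero zero * A) + (- + 1 * (N (suc zero) zero * B) + lowerTerms N))
      ≡⟨ cong -_ (det-firstColumn (suc n) N) ⟨
    - det N ∎
    where
    A = det (minor zero zero N)
    B = det (minor (suc zero) zero N)

    lowerTerms : ∀ {n} → ZMat (suc (suc n)) → ℤ
    lowerTerms N = sumℤ (λ i → sign (toℕ (suc (suc i))) * (N (suc (suc i)) zero * det (minor (suc (suc i)) zero N)))

    minor₀ : ∀ x y → minor zero zero (swapRow₀₁ N) x y ≡ minor (suc zero) zero N x y
    minor₀ zero    y = refl
    minor₀ (suc x) y = refl

    minor₁ : ∀ x y → minor (suc zero) zero (swapRow₀₁ N) x y ≡ minor zero zero N x y
    minor₁ zero    y = refl
    minor₁ (suc x) y = refl

    rearrange : ∀ s a b c d R → s * (a * b) + (- s * (c * d) + - R) ≡ - (s * (c * d) + (- s * (a * b) + R))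
    rearrange = solve-∀

    lowerTerms-swap : ∀ n (N : ZMat (suc (suc n))) → lowerTerms (swapRow₀₁ N) ≡ - lowerTerms N
    lowerTerms-swap zero    N = refl
    lowerTerms-swap (suc n) N = trans (∑-cong term-swap) (∑-neg (λ i → t i (det (minor (suc (suc i)) zero N))))
      where
      t : Fin (suc n) → ℤ → ℤ
      t i d = sign (toℕ (suc (suc i))) * (N (suc (suc i)) zero * d)

      minor-swap : ∀ i x y → minor (suc (suc i)) zero (swapRow₀₁ N) x y ≡ swapRow₀₁ (minor (suc (suc i)) zero N) x y
      minor-swap i zero          y = refl
      minor-swap i (suc zero)    y = refl
      minor-swap i (suc (suc x)) y = refl

      term-swap : ∀ i → t i (det (minor (suc (suc i)) zero (swapRow₀₁ N))) ≡ - t i (det (minor (suc (suc i)) zero N))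
      term-swap i = begin
        t i (det (minor (suc (suc i)) zero (swapRow₀₁ N)))  ≡⟨ cong (t i) (det-cong (minor-swap i)) ⟩
        t i (det (swapRow₀₁ (minor (suc (suc i)) zero N)))  ≡⟨ cong (t i) (det-swapRow₀₁ n (minor (suc (suc i)) zero N)) ⟩
        t i (- det (minor (suc (suc i)) zero N))
          ≡⟨ negate (sign (toℕ (suc (suc i)))) (N (suc (suc i)) zero) (det (minor (suc (suc i)) zero N)) ⟩
        - t i (det (minor (suc (suc i)) zero N))            ∎
        where
        negate : ∀ x y z → x * (y * - z) ≡ - (x * (y * z))
        negate = solve-∀

  raiseRow : ∀ {n} {A : Set} → Fin (suc n) → (Fin (suc n) → A) → Fin (suc n) → A
  raiseRow j N zero    = N j
  raiseRow j N (suc x) = N (punchIn j x)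

  -- Raising row j+1 is raising row j of the lower rows, then swapping the top two rows.
  det-raiseRow : ∀ n (j : Fin (suc n)) (N : ZMat (suc n)) → det (raiseRow j N) ≡ sign (toℕ j) * det N
  det-raiseRow n zero N = trans (det-cong raise₀) (sym (ℤP.*-identityˡ (det N)))
    where
    raise₀ : ∀ x y → raiseRow zero N x y ≡ N x y
    raise₀ zero    y = refl
    raise₀ (suc x) y = refl
  det-raiseRow (suc n) (suc j) N = begin
    det (raiseRow (suc j) N)  ≡⟨ det-cong raise-swap ⟩
    det (swapRow₀₁ K)         ≡⟨ det-swapRow₀₁ n K ⟩
    - det K                   ≡⟨ cong -_ (∑-cong λ l → cong (λ t → sign (toℕ l) * (N zero l * t))
                                   (trans (det-cong (minor-raise l)) (det-raiseRow n j (minor zero l N)))) ⟩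
    - sumℤ (λ l → sign (toℕ l) * (N zero l * (sign (toℕ j) * det (minor zero l N))))
                              ≡⟨ cong -_ (∑-cong λ l → pullSign (sign (toℕ l)) (N zero l) (sign (toℕ j)) (det (minor zero l N))) ⟩
    - sumℤ (λ l → sign (toℕ j) * (sign (toℕ l) * (N zero l * det (minor zero l N))))
                              ≡⟨ cong -_ (*-distribˡ-∑ (sign (toℕ j)) (λ l → sign (toℕ l) * (N zero l * det (minor zero l N)))) ⟨
    - (sign (toℕ j) * det N)  ≡⟨ ℤP.neg-distribˡ-* (sign (toℕ j)) (det N) ⟩
    sign (toℕ (suc j)) * det N ∎
    where
    K : ZMat (suc (suc n))
    K zero    = N zero
    K (suc x) = raiseRow j (N ∘ suc) x

    raise-swap : ∀ x y → raiseRow (suc j) N x y ≡ swapRow₀₁ K x y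
    raise-swap zero          y = refl
    raise-swap (suc zero)    y = refl
    raise-swap (suc (suc x)) y = refl

    minor-raise : ∀ l x y → minor zero l K x y ≡ raiseRow j (minor zero l N) x y
    minor-raise l zero    y = refl
    minor-raise l (suc x) y = refl

    pullSign : ∀ a b c d → a * (b * (c * d)) ≡ c * (a * (b * d))
    pullSign = solve-∀

  det-equalRows₀ : ∀ n (N : ZMat (suc (suc n))) (j : Fin (suc n)) → (∀ c → N zero c ≡ N (suc j) c) → det N ≡ + 0
  det-equalRows₀ n N j same = sign*x≡0⇒x≡0 (toℕ (suc j)) (det N)
    (trans (sym (det-raiseRow (suc n) (suc j) N)) (x≡-x⇒x≡0 (det R) R≡-R))
    where
    R = raiseRow (suc j) N
    swap-fixes : ∀ x y → swapRow₀₁ R x y ≡ R x y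
    swap-fixes zero          y = same y
    swap-fixes (suc zero)    y = sym (same y)
    swap-fixes (suc (suc x)) y = refl
    R≡-R : det R ≡ - det R
    R≡-R = trans (sym (det-cong swap-fixes)) (det-swapRow₀₁ n R)

  det-equalRows : ∀ n (N : ZMat n) (i j : Fin n) → i ≢ j → (∀ c → N i c ≡ N j c) → det N ≡ + 0
  det-equalRows (suc n) N zero zero i≢j _ = ⊥-elim (i≢j refl)
  det-equalRows (suc n) N (suc i) (suc j) i≢j same = trans
    (∑-cong λ l → trans
      (cong (λ t → sign (toℕ l) * (N zero l * t))
            (det-equalRows n (minor zero l N) i j (i≢j ∘ cong suc) (λ c → same (punchIn l c))))
      (trans (cong (sign (toℕ l) *_) (ℤP.*-zeroʳ (N zero l))) (ℤP.*-zeroʳ (sign (toℕ l)))))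
    (∑-zero (suc n))
  det-equalRows (suc (suc n)) N zero (suc j) _ same = det-equalRows₀ n N j same
  det-equalRows (suc (suc n)) N (suc i) zero _ same = det-equalRows₀ n N i (sym ∘ same)

  replaceRow : ∀ {n} → Fin n → (Fin n → ℤ) → ZMat n → ZMat n
  replaceRow j r M x with x Fin.≟ j
  ... | yes _ = r
  ... | no  _ = M x

  replaceRow-≡ : ∀ {n} (j : Fin n) r (M : ZMat n) → replaceRow j r M j ≡ r
  replaceRow-≡ j r M with j Fin.≟ j
  ... | yes _   = refl
  ... | no  j≢j = ⊥-elim (j≢j refl)

  replaceRow-≢ : ∀ {n} (j : Fin n) r (M : ZMat n) x → x ≢ j → replaceRow j r M x ≡ M x
  replaceRow-≢ j r M x x≢j with x Fin.≟ j
  ... | yes x≡j = ⊥-elim (x≢j x≡j)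
  ... | no  _   = refl

  replaceRow-self : ∀ {n} (i : Fin n) (M : ZMat n) x y → replaceRow i (M i) M x y ≡ M x y
  replaceRow-self i M x y with x Fin.≟ i
  ... | yes refl = refl
  ... | no  _    = refl

  -- Laplace expansion along row j, stated for an arbitrary replacement of that row.
  det-replaceRow : ∀ n (M : ZMat n) (j : Fin n) (r : Fin n → ℤ) →
                   sumℤ (λ l → r l * adj M l j) ≡ det (replaceRow j r M)
  det-replaceRow (suc n) M j r = begin
    sumℤ (λ l → r l * (sign (toℕ l ℕ.+ toℕ j) * det (minor j l M)))
      ≡⟨ ∑-cong (λ l → trans
           (cong₂ (λ u v → u * (v * det (minor j l M))) (sym (cong (λ row → row l) (replaceRow-≡ j r M))) (sign-+ (toℕ l) (toℕ j)))
           (trans (cong (λ t → M′ j l * ((sign (toℕ l) * sign (toℕ j)) * t)) (det-cong (minor-replace l)))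
                  (pullSign (M′ j l) (sign (toℕ l)) (sign (toℕ j)) (det (minor j l M′))))) ⟩
    sumℤ (λ l → sign (toℕ j) * (sign (toℕ l) * (M′ j l * det (minor j l M′))))
      ≡⟨ *-distribˡ-∑ (sign (toℕ j)) (λ l → sign (toℕ l) * (M′ j l * det (minor j l M′))) ⟨
    sign (toℕ j) * det (raiseRow j M′)           ≡⟨ cong (sign (toℕ j) *_) (det-raiseRow n j M′) ⟩
    sign (toℕ j) * (sign (toℕ j) * det M′)       ≡⟨ ℤP.*-assoc (sign (toℕ j)) (sign (toℕ j)) (det M′) ⟨
    (sign (toℕ j) * sign (toℕ j)) * det M′       ≡⟨ cong (_* det M′) (sign-involutive (toℕ j)) ⟩
    + 1 * det M′                                 ≡⟨ ℤP.*-identityˡ (det M′) ⟩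
    det M′                                       ∎
    where
    M′ = replaceRow j r M
    pullSign : ∀ a b c d → a * ((b * c) * d) ≡ c * (b * (a * d))
    pullSign = solve-∀
    minor-replace : ∀ l a b → minor j l M a b ≡ minor j l M′ a b
    minor-replace l a b = sym (cong (λ row → row (punchIn l b)) (replaceRow-≢ j r M (punchIn j a) (FinP.punchInᵢ≢i j a)))

  laplace-row : ∀ n (M : ZMat n) i → sumℤ (λ l → M i l * adj M l i) ≡ det M
  laplace-row n M i = trans (det-replaceRow n M i (M i)) (det-cong (replaceRow-self i M))

  alienCofactors-row : ∀ n (M : ZMat n) i j → i ≢ j → sumℤ (λ l → M i l * adj M l j) ≡ + 0
  alienCofactors-row n M i j i≢j = trans (det-replaceRow n M j (M i))
    (det-equalRows n (replaceRow j (M i) M) i j i≢j λ c →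
      trans (cong (λ row → row c) (replaceRow-≢ j (M i) M i i≢j)) (sym (cong (λ row → row c) (replaceRow-≡ j (M i) M))))

  adj*M≡transpose[Mᵀ*adjMᵀ] : ∀ n (M : ZMat n) i j →
    sumℤ (λ l → adj M i l * M l j) ≡ sumℤ (λ l → transpose M j l * adj (transpose M) l i)
  adj*M≡transpose[Mᵀ*adjMᵀ] (suc n) M i j = ∑-cong λ l → trans
    (cong₂ (λ s d → (s * d) * M l j) (cong sign (ℕP.+-comm (toℕ i) (toℕ l))) (sym (det-transpose n (minor l i M))))
    (ℤP.*-comm (sign (toℕ l ℕ.+ toℕ i) * det (minor i l (transpose M))) (M l j))

  laplace-col : ∀ n (M : ZMat n) i → sumℤ (λ l → adj M i l * M l i) ≡ det M
  laplace-col n M i = trans (adj*M≡transpose[Mᵀ*adjMᵀ] n M i i) (trans (laplace-row n (transpose M) i) (det-transpose n M))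

  alienCofactors-col : ∀ n (M : ZMat n) i j → i ≢ j → sumℤ (λ l → adj M i l * M l j) ≡ + 0
  alienCofactors-col n M i j i≢j = trans (adj*M≡transpose[Mᵀ*adjMᵀ] n M i j) (alienCofactors-row n (transpose M) j i (i≢j ∘ sym))

open Determinant using (laplace-row; alienCofactors-row; laplace-col; alienCofactors-col)

open import Data.Rational using (ℚ; 0ℚ; 1ℚ; mkℚ; _+_; _*_; _-_; -_)
import Data.Rational as ℚ
import Data.Rational.Properties as ℚP
import Data.Rational.Unnormalised as ℚᵘ
import Data.Rational.Unnormalised.Properties as ℚᵘP
import Data.Nat.Coprimality as Coprimality

module ℚ∑ = FiniteSum.Laws ℚP.+-*-commutativeRing sumℚ (λ _ → refl) (λ _ → refl)
open ℚ∑

module Embedding where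

  ι≡mkℚ : ∀ z → ι z ≡ mkℚ z 0 (Coprimality.sym (Coprimality.1-coprimeTo _))
  ι≡mkℚ z = ℚP.fromℚᵘ-toℚᵘ (mkℚ z 0 _)

  toℚᵘ-ι : ∀ z → ℚ.toℚᵘ (ι z) ℚᵘ.≃ ℚᵘ.mkℚᵘ z 0
  toℚᵘ-ι z = ℚᵘP.≃-reflexive (cong ℚ.toℚᵘ (ι≡mkℚ z))

  ι-+ : ∀ a b → ι (a ℤ.+ b) ≡ ι a + ι b
  ι-+ a b = ℚP.toℚᵘ-injective (ℚᵘP.≃-trans (toℚᵘ-ι (a ℤ.+ b)) (ℚᵘP.≃-trans (ℚᵘ.*≡* (lemma a b))
    (ℚᵘP.≃-sym (ℚᵘP.≃-trans (ℚP.toℚᵘ-homo-+ (ι a) (ι b)) (ℚᵘP.+-cong (toℚᵘ-ι a) (toℚᵘ-ι b))))))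
    where
    lemma : ∀ a b → (a ℤ.+ b) ℤ.* + 1 ≡ (a ℤ.* + 1 ℤ.+ b ℤ.* + 1) ℤ.* + 1
    lemma = solve-∀

  ι-* : ∀ a b → ι (a ℤ.* b) ≡ ι a * ι b
  ι-* a b = ℚP.toℚᵘ-injective (ℚᵘP.≃-trans (toℚᵘ-ι (a ℤ.* b)) (ℚᵘP.≃-trans (ℚᵘ.*≡* refl)
    (ℚᵘP.≃-sym (ℚᵘP.≃-trans (ℚP.toℚᵘ-homo-* (ι a) (ι b)) (ℚᵘP.*-cong (toℚᵘ-ι a) (toℚᵘ-ι b))))))

  ι-neg : ∀ a → ι (ℤ.- a) ≡ - ι a
  ι-neg a = ℚP.toℚᵘ-injective (ℚᵘP.≃-trans (toℚᵘ-ι (ℤ.- a)) (ℚᵘP.≃-trans (ℚᵘ.*≡* refl)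
    (ℚᵘP.≃-sym (ℚᵘP.≃-trans (ℚP.toℚᵘ-homo‿- (ι a)) (ℚᵘP.-‿cong (toℚᵘ-ι a))))))

  ι≡0⇒≡0 : ∀ z → ι z ≡ 0ℚ → z ≡ + 0
  ι≡0⇒≡0 z e = cong ℚ.↥_ (trans (sym (ι≡mkℚ z)) e)

  ι-∑ : ∀ {n} (f : Fin n → ℤ) → ι (sumℤ f) ≡ sumℚ (λ i → ι (f i))
  ι-∑ {zero}  f = refl
  ι-∑ {suc n} f = trans (ι-+ (f zero) (sumℤ (f ∘ suc))) (cong (_+_ (ι (f zero))) (ι-∑ (f ∘ suc)))

open Embedding using (ι-+; ι-*; ι-neg; ι≡0⇒≡0; ι-∑)

module ≋-Reasoning {m : ℕ} = Relation.Binary.Reasoning.Setoid (Fin m →-setoid ℚ)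

≋-refl : ∀ {m} {x : QVec m} → x ≋ x
≋-refl i = refl

≋-sym : ∀ {m} {x y : QVec m} → x ≋ y → y ≋ x
≋-sym x≋y i = sym (x≋y i)

≋-trans : ∀ {m} {x y z : QVec m} → x ≋ y → y ≋ z → x ≋ z
≋-trans x≋y y≋z i = trans (x≋y i) (y≋z i)

module LinearAlgebra {m : ℕ} where

  ·-cong : ∀ (A : QMat m) {x y : QVec m} → x ≋ y → (A · x) ≋ (A · y)
  ·-cong A x≋y i = ∑-cong λ l → cong (A i l *_) (x≋y l)

  ·-congˡ : ∀ {A B : QMat m} (x : QVec m) → (∀ i j → A i j ≡ B i j) → (A · x) ≋ (B · x)
  ·-congˡ x A≡B i = ∑-cong λ l → cong (_* x l) (A≡B i l)

  ·-distrib-+ᵥ : ∀ (A : QMat m) x y → (A · (x +ᵥ y)) ≋ ((A · x) +ᵥ (A · y))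
  ·-distrib-+ᵥ A x y i = trans (∑-cong λ l → ℚP.*-distribˡ-+ (A i l) (x l) (y l))
                               (∑-distrib-+ (λ l → A i l * x l) (λ l → A i l * y l))

  ·-distrib-−ᵥ : ∀ (A : QMat m) x y → (A · (x -ᵥ y)) ≋ ((A · x) -ᵥ (A · y))
  ·-distrib-−ᵥ A x y i = begin
    sumℚ (λ l → A i l * (x l - y l))             ≡⟨ ∑-cong (λ l → ℚP.*-distribˡ-+ (A i l) (x l) (- y l)) ⟩
    sumℚ (λ l → A i l * x l + A i l * - y l)     ≡⟨ ∑-cong (λ l → cong (_+_ (A i l * x l)) (sym (ℚP.neg-distribʳ-* (A i l) (y l)))) ⟩
    sumℚ (λ l → A i l * x l + - (A i l * y l))   ≡⟨ ∑-distrib-+ (λ l → A i l * x l) (λ l → - (A i l * y l)) ⟩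
    (A · x) i + sumℚ (λ l → - (A i l * y l))     ≡⟨ cong (_+_ ((A · x) i)) (∑-neg (λ l → A i l * y l)) ⟩
    (A · x) i - (A · y) i                        ∎
    where open ≡-Reasoning

  ·-0ᵥ : ∀ (A : QMat m) → (A · 0ᵥ) ≋ 0ᵥ
  ·-0ᵥ A i = trans (∑-cong λ l → ℚP.*-zeroʳ (A i l)) (∑-zero m)

  ⊗-· : ∀ (A B : QMat m) x → ((A ⊗ B) · x) ≋ (A · (B · x))
  ⊗-· A B x i = begin
    sumℚ (λ l → sumℚ (λ k → A i k * B k l) * x l)    ≡⟨ ∑-cong (λ l → *-distribʳ-∑ (x l) (λ k → A i k * B k l)) ⟩
    sumℚ (λ l → sumℚ (λ k → (A i k * B k l) * x l))  ≡⟨ ∑-comm (λ l k → (A i k * B k l) * x l) ⟩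
    sumℚ (λ k → sumℚ (λ l → (A i k * B k l) * x l))  ≡⟨ ∑-cong (λ k → ∑-cong (λ l → ℚP.*-assoc (A i k) (B k l) (x l))) ⟩
    sumℚ (λ k → sumℚ (λ l → A i k * (B k l * x l)))  ≡⟨ ∑-cong (λ k → *-distribˡ-∑ (A i k) (λ l → B k l * x l)) ⟨
    sumℚ (λ k → A i k * sumℚ (λ l → B k l * x l))    ∎
    where open ≡-Reasoning

  idQ-· : ∀ (x : QVec m) → (idQ · x) ≋ x
  idQ-· x i = trans (∑-single i (λ l → idQ i l * x l) off-diagonal) (trans (cong (_* x i) diagonal) (ℚP.*-identityˡ (x i)))
    where
    diagonal : idQ i i ≡ 1ℚ
    diagonal with i Fin.≟ i
    ... | yes _   = refl
    ... | no  i≢i = ⊥-elim (i≢i refl)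
    off-diagonal : ∀ l → l ≢ i → idQ i l * x l ≡ 0ℚ
    off-diagonal l l≢i with i Fin.≟ l
    ... | yes i≡l = ⊥-elim (l≢i (sym i≡l))
    ... | no  _   = ℚP.*-zeroˡ (x l)

  iterate : QMat m → ℕ → QVec m → QVec m
  iterate A zero    v = v
  iterate A (suc n) v = A · iterate A n v

  iterate-cong : ∀ A n {x y : QVec m} → x ≋ y → iterate A n x ≋ iterate A n y
  iterate-cong A zero    x≋y = x≋y
  iterate-cong A (suc n) x≋y = ·-cong A (iterate-cong A n x≋y)

  iterate-sucʳ : ∀ A n v → iterate A (suc n) v ≋ iterate A n (A · v)
  iterate-sucʳ A zero    v = ≋-refl
  iterate-sucʳ A (suc n) v = ·-cong A (iterate-sucʳ A n v)

  iterate-+ : ∀ A a b v → iterate A a (iterate A b v) ≋ iterate A (a ℕ.+ b) v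
  iterate-+ A zero    b v = ≋-refl
  iterate-+ A (suc a) b v = ·-cong A (iterate-+ A a b v)

  iterate-distrib-+ᵥ : ∀ A n x y → iterate A n (x +ᵥ y) ≋ (iterate A n x +ᵥ iterate A n y)
  iterate-distrib-+ᵥ A zero    x y = ≋-refl
  iterate-distrib-+ᵥ A (suc n) x y = ≋-trans (·-cong A (iterate-distrib-+ᵥ A n x y)) (·-distrib-+ᵥ A _ _)

  iterate-distrib-−ᵥ : ∀ A n x y → iterate A n (x -ᵥ y) ≋ (iterate A n x -ᵥ iterate A n y)
  iterate-distrib-−ᵥ A zero    x y = ≋-refl
  iterate-distrib-−ᵥ A (suc n) x y = ≋-trans (·-cong A (iterate-distrib-−ᵥ A n x y)) (·-distrib-−ᵥ A _ _)

  powN-· : ∀ A n v → (powN A n · v) ≋ iterate A n v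
  powN-· A zero    v = idQ-· v
  powN-· A (suc n) v = ≋-trans (⊗-· A (powN A n) v) (·-cong A (powN-· A n v))

open LinearAlgebra

open import Algebra.Properties.CommutativeSemigroup
  (CommutativeMonoid.commutativeSemigroup ℚP.*-1-commutativeMonoid)
  using (interchange; x∙yz≈y∙xz)

recip-inverseˡ : ∀ p → p ≢ 0ℚ → recip p * p ≡ 1ℚ
recip-inverseˡ p p≢0 with p ℚP.≟ 0ℚ
... | yes p≡0 = ⊥-elim (p≢0 p≡0)
... | no  p≢0 = ℚP.*-inverseˡ p {{ℚ.≢-nonZero p≢0}}

*-inverse-unique : ∀ x y p → x * p ≡ 1ℚ → y * p ≡ 1ℚ → x ≡ y
*-inverse-unique x y p x*p≡1 y*p≡1 = begin
  x              ≡⟨ ℚP.*-identityʳ x ⟨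
  x * 1ℚ         ≡⟨ cong (x *_) y*p≡1 ⟨
  x * (y * p)    ≡⟨ x∙yz≈y∙xz x y p ⟩
  y * (x * p)    ≡⟨ cong (y *_) x*p≡1 ⟩
  y * 1ℚ         ≡⟨ ℚP.*-identityʳ y ⟩
  y              ∎
  where open ≡-Reasoning

module Inverse {m : ℕ} (M : ZMat m) (det≢0 : det M ≢ + 0) where

  Δ⁻¹ : ℚ
  Δ⁻¹ = recip (ι (det M))

  Δ⁻¹*Δ : Δ⁻¹ * ι (det M) ≡ 1ℚ
  Δ⁻¹*Δ = recip-inverseˡ (ι (det M)) (det≢0 ∘ ι≡0⇒≡0 (det M))

  Δ⁻¹*Δδ≡idQ : ∀ (i j : Fin m) s → (i ≡ j → s ≡ det M) → (i ≢ j → s ≡ + 0) → Δ⁻¹ * ι s ≡ idQ i j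
  Δ⁻¹*Δδ≡idQ i j s diagonal off-diagonal with i Fin.≟ j
  ... | yes i≡j = trans (cong (λ t → Δ⁻¹ * ι t) (diagonal i≡j)) Δ⁻¹*Δ
  ... | no  i≢j = trans (cong (λ t → Δ⁻¹ * ι t) (off-diagonal i≢j)) (ℚP.*-zeroʳ Δ⁻¹)

  M⊗inv : ∀ i j → (ιM M ⊗ inv M) i j ≡ idQ i j
  M⊗inv i j = begin
    sumℚ (λ l → ι (M i l) * (Δ⁻¹ * ι (adj M l j)))  ≡⟨ ∑-cong (λ l → trans (x∙yz≈y∙xz (ι (M i l)) Δ⁻¹ (ι (adj M l j)))
                                                                             (cong (Δ⁻¹ *_) (sym (ι-* (M i l) (adj M l j))))) ⟩
    sumℚ (λ l → Δ⁻¹ * ι (M i l ℤ.* adj M l j))     ≡⟨ *-distribˡ-∑ Δ⁻¹ (λ l → ι (M i l ℤ.* adj M l j)) ⟨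
    Δ⁻¹ * sumℚ (λ l → ι (M i l ℤ.* adj M l j))     ≡⟨ cong (Δ⁻¹ *_) (ι-∑ (λ l → M i l ℤ.* adj M l j)) ⟨
    Δ⁻¹ * ι (sumℤ (λ l → M i l ℤ.* adj M l j))     ≡⟨ Δ⁻¹*Δδ≡idQ i j _ (λ { refl → laplace-row m M i }) (alienCofactors-row m M i j) ⟩
    idQ i j                                        ∎
    where open ≡-Reasoning

  inv⊗M : ∀ i j → (inv M ⊗ ιM M) i j ≡ idQ i j
  inv⊗M i j = begin
    sumℚ (λ l → (Δ⁻¹ * ι (adj M i l)) * ι (M l j))  ≡⟨ ∑-cong (λ l → trans (ℚP.*-assoc Δ⁻¹ (ι (adj M i l)) (ι (M l j)))
                                                                             (cong (Δ⁻¹ *_) (sym (ι-* (adj M i l) (M l j))))) ⟩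
    sumℚ (λ l → Δ⁻¹ * ι (adj M i l ℤ.* M l j))     ≡⟨ *-distribˡ-∑ Δ⁻¹ (λ l → ι (adj M i l ℤ.* M l j)) ⟨
    Δ⁻¹ * sumℚ (λ l → ι (adj M i l ℤ.* M l j))     ≡⟨ cong (Δ⁻¹ *_) (ι-∑ (λ l → adj M i l ℤ.* M l j)) ⟨
    Δ⁻¹ * ι (sumℤ (λ l → adj M i l ℤ.* M l j))     ≡⟨ Δ⁻¹*Δδ≡idQ i j _ (λ { refl → laplace-col m M i }) (alienCofactors-col m M i j) ⟩
    idQ i j                                        ∎
    where open ≡-Reasoning

  M·inv· : ∀ x → (ιM M · (inv M · x)) ≋ x
  M·inv· x = ≋-trans (≋-sym (⊗-· (ιM M) (inv M) x)) (≋-trans (·-congˡ x M⊗inv) (idQ-· x))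

  inv·M· : ∀ x → (inv M · (ιM M · x)) ≋ x
  inv·M· x = ≋-trans (≋-sym (⊗-· (inv M) (ιM M) x)) (≋-trans (·-congˡ x inv⊗M) (idQ-· x))

module Powers {m : ℕ} (M : ZMat m) (det≢0 : det M ≢ + 0) where

  open Inverse M det≢0 using (M·inv·; inv·M·)

  act : ℤ → QVec m → QVec m
  act (+ n)    = iterate (ιM M) n
  act -[1+ n ] = iterate (inv M) (suc n)

  ^ᶻ-·≋act : ∀ k v → ((M ^ᶻ k) · v) ≋ act k v
  ^ᶻ-·≋act (+ n)    v = powN-· (ιM M) n v
  ^ᶻ-·≋act -[1+ n ] v = powN-· (inv M) (suc n) v

  act-cong : ∀ k {x y} → x ≋ y → act k x ≋ act k y
  act-cong (+ n)    = iterate-cong (ιM M) n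
  act-cong -[1+ n ] = iterate-cong (inv M) (suc n)

  act-≡ : ∀ {k k′} v → k ≡ k′ → act k v ≋ act k′ v
  act-≡ v refl = ≋-refl

  iterate-M-inv : ∀ a b v → iterate (ιM M) a (iterate (inv M) b v) ≋ act (a ℤ.⊖ b) v
  iterate-M-inv a       zero    v = ≋-refl
  iterate-M-inv zero    (suc b) v = ≋-refl
  iterate-M-inv (suc a) (suc b) v = ≋-trans (iterate-sucʳ (ιM M) a _) (≋-trans (iterate-cong (ιM M) a (M·inv· _))
    (≋-trans (iterate-M-inv a b v) (act-≡ v (sym (ℤP.[1+m]⊖[1+n]≡m⊖n a b)))))

  iterate-inv-M : ∀ a b v → iterate (inv M) a (iterate (ιM M) b v) ≋ act (b ℤ.⊖ a) v
  iterate-inv-M zero    b       v = ≋-refl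
  iterate-inv-M (suc a) zero    v = ≋-refl
  iterate-inv-M (suc a) (suc b) v = ≋-trans (iterate-sucʳ (inv M) a _) (≋-trans (iterate-cong (inv M) a (inv·M· _))
    (≋-trans (iterate-inv-M a b v) (act-≡ v (sym (ℤP.[1+m]⊖[1+n]≡m⊖n b a)))))

  act-+ : ∀ k j v → act k (act j v) ≋ act (k ℤ.+ j) v
  act-+ (+ a)    (+ b)    v = iterate-+ (ιM M) a b v
  act-+ (+ a)    -[1+ b ] v = iterate-M-inv a (suc b) v
  act-+ -[1+ a ] (+ b)    v = iterate-inv-M (suc a) b v
  act-+ -[1+ a ] -[1+ b ] v = ≋-trans (iterate-+ (inv M) (suc a) (suc b) v)
                                      (λ i → cong (λ n → iterate (inv M) (suc n) v i) (ℕP.+-suc a b))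

  ^ᶻ-·-+ : ∀ k j v → ((M ^ᶻ k) · ((M ^ᶻ j) · v)) ≋ ((M ^ᶻ (k ℤ.+ j)) · v)
  ^ᶻ-·-+ k j v = begin
    (M ^ᶻ k) · ((M ^ᶻ j) · v)  ≈⟨ ^ᶻ-·≋act k _ ⟩
    act k ((M ^ᶻ j) · v)       ≈⟨ act-cong k (^ᶻ-·≋act j v) ⟩
    act k (act j v)            ≈⟨ act-+ k j v ⟩
    act (k ℤ.+ j) v            ≈⟨ ^ᶻ-·≋act (k ℤ.+ j) v ⟨
    (M ^ᶻ (k ℤ.+ j)) · v       ∎
    where open ≋-Reasoning

  ^ᶻ-·-cancel : ∀ k j v → k ℤ.+ j ≡ + 0 → ((M ^ᶻ k) · ((M ^ᶻ j) · v)) ≋ v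
  ^ᶻ-·-cancel k j v k+j≡0 = ≋-trans (^ᶻ-·-+ k j v) (≋-trans (λ i → cong (λ e → ((M ^ᶻ e) · v) i) k+j≡0) (idQ-· v))

  iterate-inv-M-cancel : ∀ n v → iterate (inv M) n (iterate (ιM M) n v) ≋ v
  iterate-inv-M-cancel n v = ≋-trans (iterate-inv-M n n v) (act-≡ v (ℤP.n⊖n≡0 n))



IsIntegral : ∀ {m} → QVec m → Set
IsIntegral {m} v = Σ[ z ∈ ZVec m ] v ≋ ιv z

isIntegral-≋ : ∀ {m} {v w : QVec m} → IsIntegral v → w ≋ v → IsIntegral w
isIntegral-≋ (z , v≋z) w≋v = z , ≋-trans w≋v v≋z

isIntegral-+ᵥ : ∀ {m} {v w : QVec m} → IsIntegral v → IsIntegral w → IsIntegral (v +ᵥ w)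
isIntegral-+ᵥ (z , v≋z) (z′ , w≋z′) =
  (λ i → z i ℤ.+ z′ i) , λ i → trans (cong₂ _+_ (v≋z i) (w≋z′ i)) (sym (ι-+ (z i) (z′ i)))

isIntegral-−ᵥ : ∀ {m} {v w : QVec m} → IsIntegral v → IsIntegral w → IsIntegral (v -ᵥ w)
isIntegral-−ᵥ (z , v≋z) (z′ , w≋z′) =
  (λ i → z i ℤ.- z′ i) , λ i → trans (cong₂ _-_ (v≋z i) (w≋z′ i))
                                     (trans (cong (_+_ (ι (z i))) (sym (ι-neg (z′ i)))) (sym (ι-+ (z i) (ℤ.- z′ i))))

isIntegral-· : ∀ {m} (M : ZMat m) {v} → IsIntegral v → IsIntegral (ιM M · v)
isIntegral-· M (z , v≋z) = (λ i → sumℤ (λ l → M i l ℤ.* z l)) ,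
  λ i → trans (∑-cong λ l → trans (cong (ι (M i l) *_) (v≋z l)) (sym (ι-* (M i l) (z l))))
              (sym (ι-∑ (λ l → M i l ℤ.* z l)))

isIntegral-iterate : ∀ {m} (M : ZMat m) n {v} → IsIntegral v → IsIntegral (iterate (ιM M) n v)
isIntegral-iterate M zero    v-int = v-int
isIntegral-iterate M (suc n) v-int = isIntegral-· M (isIntegral-iterate M n v-int)

^-≢0 : ∀ (d : ℤ) a → d ≢ + 0 → d ℤ.^ a ≢ + 0
^-≢0 d zero    d≢0 ()
^-≢0 d (suc a) d≢0 dᵃ⁺¹≡0 with ℤP.i*j≡0⇒i≡0∨j≡0 d dᵃ⁺¹≡0
... | inj₁ d≡0  = d≢0 d≡0
... | inj₂ dᵃ≡0 = ^-≢0 d a d≢0 dᵃ≡0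

module Integrality {m : ℕ} (M : ZMat m) (det≢0 : det M ≢ + 0) where

  open Inverse M det≢0 using (Δ⁻¹; Δ⁻¹*Δ)
  open Powers M det≢0 using (^ᶻ-·-cancel; iterate-inv-M-cancel)

  EventuallyIntegral : QVec m → Set
  EventuallyIntegral x = Σ[ N ∈ ℕ ] IsIntegral (iterate (ιM M) N x)

  eventuallyIntegral-≋ : ∀ {x y} → EventuallyIntegral x → y ≋ x → EventuallyIntegral y
  eventuallyIntegral-≋ (N , Nx-int) y≋x = N , isIntegral-≋ Nx-int (iterate-cong (ιM M) N y≋x)

  isIntegral-iterate-+ : ∀ c N x → IsIntegral (iterate (ιM M) N x) → IsIntegral (iterate (ιM M) (c ℕ.+ N) x)
  isIntegral-iterate-+ c N x Nx-int =
    isIntegral-≋ (isIntegral-iterate M c Nx-int) (≋-sym (iterate-+ (ιM M) c N x))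

  eventuallyIntegral-common : ∀ {x y} → EventuallyIntegral x → EventuallyIntegral y →
    Σ[ N ∈ ℕ ] IsIntegral (iterate (ιM M) N x) × IsIntegral (iterate (ιM M) N y)
  eventuallyIntegral-common {x} {y} (N₁ , p) (N₂ , q) = N₂ ℕ.+ N₁ ,
    isIntegral-iterate-+ N₂ N₁ x p ,
    subst (λ n → IsIntegral (iterate (ιM M) n y)) (ℕP.+-comm N₁ N₂) (isIntegral-iterate-+ N₁ N₂ y q)

  eventuallyIntegral-+ᵥ : ∀ {x y} → EventuallyIntegral x → EventuallyIntegral y → EventuallyIntegral (x +ᵥ y)
  eventuallyIntegral-+ᵥ {x} {y} x-int y-int with eventuallyIntegral-common x-int y-int
  ... | N , p , q = N , isIntegral-≋ (isIntegral-+ᵥ p q) (iterate-distrib-+ᵥ (ιM M) N x y)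

  eventuallyIntegral-−ᵥ : ∀ {x y} → EventuallyIntegral x → EventuallyIntegral y → EventuallyIntegral (x -ᵥ y)
  eventuallyIntegral-−ᵥ {x} {y} x-int y-int with eventuallyIntegral-common x-int y-int
  ... | N , p , q = N , isIntegral-≋ (isIntegral-−ᵥ p q) (iterate-distrib-−ᵥ (ιM M) N x y)

  eventuallyIntegral-^ᶻ : ∀ k (d : ZVec m) → EventuallyIntegral ((M ^ᶻ k) · ιv d)
  eventuallyIntegral-^ᶻ (+ n)    d = 0 , (isIntegral-≋ (isIntegral-iterate M n (d , ≋-refl)) (powN-· (ιM M) n (ιv d)))
  eventuallyIntegral-^ᶻ -[1+ n ] d = suc n , d ,
    ≋-trans (≋-sym (powN-· (ιM M) (suc n) _)) (^ᶻ-·-cancel (+ suc n) -[1+ n ] (ιv d) (ℤP.+-inverseʳ (+ suc n)))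

  scale : ℕ → ℚ
  scale a = recip (ι (det M ℤ.^ a))

  scale-inverse : ∀ a → scale a * ι (det M ℤ.^ a) ≡ 1ℚ
  scale-inverse a = recip-inverseˡ _ (^-≢0 (det M) a det≢0 ∘ ι≡0⇒≡0 _)

  scale-suc : ∀ a → Δ⁻¹ * scale a ≡ scale (suc a)
  scale-suc a = *-inverse-unique _ _ (ι (det M ℤ.^ suc a)) (begin
    (Δ⁻¹ * scale a) * ι (det M ℤ.* det M ℤ.^ a)         ≡⟨ cong ((Δ⁻¹ * scale a) *_) (ι-* (det M) (det M ℤ.^ a)) ⟩
    (Δ⁻¹ * scale a) * (ι (det M) * ι (det M ℤ.^ a))     ≡⟨ interchange Δ⁻¹ (scale a) (ι (det M)) (ι (det M ℤ.^ a)) ⟩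
    (Δ⁻¹ * ι (det M)) * (scale a * ι (det M ℤ.^ a))     ≡⟨ cong₂ _*_ Δ⁻¹*Δ (scale-inverse a) ⟩
    1ℚ                                                  ∎)
    (scale-inverse (suc a))
    where open ≡-Reasoning

  inv-scaledLattice : ∀ {a v} → InScaledLattice (det M) a v → InScaledLattice (det M) (suc a) (inv M · v)
  inv-scaledLattice {a} {v} (z , v≡) = (λ i → sumℤ (λ l → adj M i l ℤ.* z l)) , λ i → begin
    sumℚ (λ l → (Δ⁻¹ * ι (adj M i l)) * v l)                  ≡⟨ ∑-cong (λ l → cong ((Δ⁻¹ * ι (adj M i l)) *_) (v≡ l)) ⟩
    sumℚ (λ l → (Δ⁻¹ * ι (adj M i l)) * (scale a * ι (z l)))  ≡⟨ ∑-cong (λ l → trans (interchange Δ⁻¹ (ι (adj M i l)) (scale a) (ι (z l)))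
                                                                                     (cong ((Δ⁻¹ * scale a) *_) (sym (ι-* (adj M i l) (z l))))) ⟩
    sumℚ (λ l → (Δ⁻¹ * scale a) * ι (adj M i l ℤ.* z l))      ≡⟨ *-distribˡ-∑ (Δ⁻¹ * scale a) (λ l → ι (adj M i l ℤ.* z l)) ⟨
    (Δ⁻¹ * scale a) * sumℚ (λ l → ι (adj M i l ℤ.* z l))      ≡⟨ cong₂ _*_ (scale-suc a) (sym (ι-∑ (λ l → adj M i l ℤ.* z l))) ⟩
    scale (suc a) * ι (sumℤ (λ l → adj M i l ℤ.* z l))        ∎
    where open ≡-Reasoning

  iterate-inv-scaledLattice : ∀ n (z : ZVec m) → InScaledLattice (det M) n (iterate (inv M) n (ιv z))
  iterate-inv-scaledLattice zero    z = z , λ i → sym (ℚP.*-identityˡ (ι (z i)))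
  iterate-inv-scaledLattice (suc n) z = inv-scaledLattice {n} (iterate-inv-scaledLattice n z)

  eventuallyIntegral⇒scaledLattice : ∀ {x} → EventuallyIntegral x → Σ[ a ∈ ℕ ] InScaledLattice (det M) a x
  eventuallyIntegral⇒scaledLattice {x} (N , z , Nx≋z) = N , w , λ i → trans (x≋ i) (w≡ i)
    where
    w = proj₁ (iterate-inv-scaledLattice N z)
    w≡ = proj₂ (iterate-inv-scaledLattice N z)
    x≋ : x ≋ iterate (inv M) N (ιv z)
    x≋ = ≋-trans (≋-sym (iterate-inv-M-cancel N x)) (iterate-cong (inv M) N Nx≋z)

module DigitExpansions {m : ℕ} (M : ZMat m) (det≢0 : det M ≢ + 0) (D : Digits m) where

  open Powers M det≢0 using (^ᶻ-·-+; ^ᶻ-·-cancel)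
  open Integrality M det≢0 using (EventuallyIntegral; eventuallyIntegral-≋; eventuallyIntegral-+ᵥ; eventuallyIntegral-^ᶻ)
  open Algebra.Properties.Group (AbelianGroup.group ℤP.+-0-abelianGroup) using (∙-cancelˡ)

  FinD-≋ : ∀ {x y} → FinD M D x → y ≋ x → FinD M D y
  FinD-≋ (r , x≋) y≋x = r , ≋-trans y≋x x≋

  shift : ℤ → List (ℤ × Fin (length D)) → List (ℤ × Fin (length D))
  shift k = map (map₁ (ℤ._+_ k))

  evalList-shift : ∀ k ks → evalList M D (shift k ks) ≋ ((M ^ᶻ k) · evalList M D ks)
  evalList-shift k []             = ≋-sym (·-0ᵥ (M ^ᶻ k))
  evalList-shift k ((j , d) ∷ ks) = ≋-sym (≋-trans (·-distrib-+ᵥ (M ^ᶻ k) _ _)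
    (λ i → cong₂ _+_ (^ᶻ-·-+ k j (ιv (digit D d)) i) (sym (evalList-shift k ks i))))

  shift-unique : ∀ k ks → Unique (map proj₁ ks) → Unique (map proj₁ (shift k ks))
  shift-unique k ks u = subst Unique (trans (sym (ListP.map-∘ ks)) (ListP.map-∘ ks))
                                     (UniqueP.map⁺ (∙-cancelˡ k _ _) u)

  shift-≢[] : ∀ k ks → ks ≢ [] → shift k ks ≢ []
  shift-≢[] k []      ks≢[] = ⊥-elim (ks≢[] refl)
  shift-≢[] k (_ ∷ _) _     ()

  FinD-^ᶻ : ∀ k {x} → FinD M D x → FinD M D ((M ^ᶻ k) · x)
  FinD-^ᶻ k ((ks , u , ks≢[]) , x≋) =
    (shift k ks , shift-unique k ks u , shift-≢[] k ks ks≢[]) ,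
    ≋-trans (·-cong (M ^ᶻ k) x≋) (≋-sym (evalList-shift k ks))

  evalList-eventuallyIntegral : ∀ ks → EventuallyIntegral (evalList M D ks)
  evalList-eventuallyIntegral []             = 0 , (λ _ → + 0) , ≋-refl
  evalList-eventuallyIntegral ((k , d) ∷ ks) =
    eventuallyIntegral-+ᵥ (eventuallyIntegral-^ᶻ k (digit D d)) (evalList-eventuallyIntegral ks)

  FinD⇒eventuallyIntegral : ∀ {x} → FinD M D x → EventuallyIntegral x
  FinD⇒eventuallyIntegral ((ks , _) , x≋) =
    eventuallyIntegral-≋ (evalList-eventuallyIntegral ks) x≋

  eventuallyIntegral⇒FinD : (∀ z → FinD M D (ιv z)) → ∀ {x} → EventuallyIntegral x → FinD M D x
  eventuallyIntegral⇒FinD ℤᵐ⊆FinD {x} (N , z , Nx≋z) = FinD-≋ (FinD-^ᶻ (ℤ.- + N) (ℤᵐ⊆FinD z)) (begin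
    x                                        ≈⟨ ^ᶻ-·-cancel (ℤ.- + N) (+ N) x (ℤP.+-inverseˡ (+ N)) ⟨
    (M ^ᶻ (ℤ.- + N)) · ((M ^ᶻ (+ N)) · x)     ≈⟨ ·-cong (M ^ᶻ (ℤ.- + N)) (powN-· (ιM M) N x) ⟩
    (M ^ᶻ (ℤ.- + N)) · iterate (ιM M) N x     ≈⟨ ·-cong (M ^ᶻ (ℤ.- + N)) Nx≋z ⟩
    (M ^ᶻ (ℤ.- + N)) · ιv z                   ∎)
    where open ≋-Reasoning

lemma4p1 : (m : ℕ) (M : ZMat m) (D : Digits m) → HasZero D → det M ≢ + 0 →
    ((k : ℤ) →
      ((x : QVec m) → FinD M D x → FinD M D ((M ^ᶻ k) · x))
      × ((y : QVec m) → FinD M D y → Σ (QVec m) λ x → FinD M D x × ((M ^ᶻ k) · x) ≋ y))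
    × ((x : QVec m) → FinD M D x → Σ ℕ λ k → InScaledLattice (det M) k x)
    × (((z : ZVec m) → FinD M D (ιv z)) →
        ((x y : QVec m) → FinD M D x → FinD M D y → FinD M D (x +ᵥ y) × FinD M D (x -ᵥ y)))
lemma4p1 m M D _ det≢0 = invariance , boundedDenominators , closure
  where
  open Powers M det≢0 using (^ᶻ-·-cancel)
  open Integrality M det≢0 using (eventuallyIntegral-+ᵥ; eventuallyIntegral-−ᵥ; eventuallyIntegral⇒scaledLattice)
  open DigitExpansions M det≢0 D using (FinD-^ᶻ; FinD⇒eventuallyIntegral; eventuallyIntegral⇒FinD)

  invariance = λ k →
    (λ x → FinD-^ᶻ k) ,
    (λ y y∈ → (M ^ᶻ (ℤ.- k)) · y , FinD-^ᶻ (ℤ.- k) y∈ , ^ᶻ-·-cancel k (ℤ.- k) y (ℤP.+-inverseʳ k))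

  boundedDenominators = λ x x∈ → eventuallyIntegral⇒scaledLattice (FinD⇒eventuallyIntegral x∈)

  closure = λ ℤᵐ⊆FinD x y x∈ y∈ →
    eventuallyIntegral⇒FinD ℤᵐ⊆FinD (eventuallyIntegral-+ᵥ (FinD⇒eventuallyIntegral x∈) (FinD⇒eventuallyIntegral y∈)) ,
    eventuallyIntegral⇒FinD ℤᵐ⊆FinD (eventuallyIntegral-−ᵥ (FinD⇒eventuallyIntegral x∈) (FinD⇒eventuallyIntegral y∈))
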